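{- For $n\ge 1$, the maximum, over all HV-palindromes $w$ of size $(3,n)$ (over any finite alphabet), of the number of distinct non-empty HV-palindromic factors of $w$ is $3n$; for distinct letters $a,b$, the word with rows $a^n$, $b^n$, $a^n$ attains this value.
   Context: A 2D word of size $(m,n)$ over a finite alphabet $\Sigma$ is an $m\times n$ array $w=[w_{i,j}]$ with entries in $\Sigma$; its rows and columns are 1D words. A 1D word is a palindrome if it equals its reversal; a 2D word is an HV-palindrome if each of its rows and each of its columns is a 1D palindrome. A factor of $w$ is a sub-array of consecutive rows and columns, considered as a 2D word; factors are counted as distinct arrays, independently of their positions. -}

module Defs where

open import Data.Nat using (ℕ; zero; suc; _+_; _≤_; _≤?_)
open import Data.Nat.Properties using (+-monoʳ-<; ≤-trans)
open import Data.Fin using (Fin; toℕ; fromℕ<; opposite)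
open import Data.Fin.Properties using (toℕ<n; all?) renaming (_≟_ to _≟ᶠ_)
open import Data.List using (List; []; _∷_; [_]; map; concatMap; upTo; length; filter; deduplicate)
open import Data.Nat.ListAction using (sum)
open import Data.Product using (_×_; _,_)
open import Relation.Nullary using (Dec; yes; no)
open import Relation.Nullary.Decidable using (_×-dec_)
open import Relation.Binary.PropositionalEquality using (_≡_)

Word2 : Set → ℕ → ℕ → Set
Word2 A m n = Fin m → Fin n → A

IsPalindrome : {A : Set} {n : ℕ} → (Fin n → A) → Set
IsPalindrome {n = n} f = ∀ (j : Fin n) → f j ≡ f (opposite j)

row : {A : Set} {m n : ℕ} → Word2 A m n → Fin m → Fin n → A
row w i = λ j → w i j

col : {A : Set} {m n : ℕ} → Word2 A m n → Fin n → Fin m → A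
col w j = λ i → w i j

IsHVPal : {A : Set} {m n : ℕ} → Word2 A m n → Set
IsHVPal {m = m} {n = n} w =
  (∀ (i : Fin m) → IsPalindrome (row w i)) × (∀ (j : Fin n) → IsPalindrome (col w j))

isHVPal? : {k m n : ℕ} → (w : Word2 (Fin k) m n) → Dec (IsHVPal w)
isHVPal? w =
  all? (λ i → all? (λ j → row w i j ≟ᶠ row w i (opposite j)))
  ×-dec all? (λ j → all? (λ i → col w j i ≟ᶠ col w j (opposite i)))

_≈₂_ : {A : Set} {p q : ℕ} → Word2 A p q → Word2 A p q → Set
u ≈₂ v = ∀ r s → u r s ≡ v r s

_≈₂?_ : {k p q : ℕ} → (u v : Word2 (Fin k) p q) → Dec (u ≈₂ v)
u ≈₂? v = all? (λ r → all? (λ s → u r s ≟ᶠ v r s))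

shift : (m p i : ℕ) → i + p ≤ m → Fin p → Fin m
shift m p i h r = fromℕ< (≤-trans (+-monoʳ-< i (toℕ<n r)) h)

placements : (m p : ℕ) → List (Fin p → Fin m)
placements m p = concatMap one (upTo m)
  where
  one : ℕ → List (Fin p → Fin m)
  one i with i + p ≤? m
  ... | yes h = [ shift m p i h ]
  ... | no _  = []

factorsOfSize : {A : Set} {m n : ℕ} → (p q : ℕ) → Word2 A m n → List (Word2 A p q)
factorsOfSize {m = m} {n = n} p q w =
  concatMap (λ f → map (λ g → λ r s → w (f r) (g s)) (placements n q)) (placements m p)

hvPalFactorsOfSize : {k m n : ℕ} → (p q : ℕ) → Word2 (Fin k) m n → ℕ
hvPalFactorsOfSize p q w =
  length (deduplicate _≈₂?_ (filter isHVPal? (factorsOfSize p q w)))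

-- Number of distinct non-empty HV-palindromic factors of w
-- (factors of different sizes are distinct arrays, so we sum over sizes
--  (p,q) with 1 ≤ p ≤ m, 1 ≤ q ≤ n).
numHVPalFactors : {k m n : ℕ} → Word2 (Fin k) m n → ℕ
numHVPalFactors {m = m} {n = n} w =
  sum (map (λ p → sum (map (λ q → hvPalFactorsOfSize (suc p) (suc q) w) (upTo n))) (upTo m))

aba : {A : Set} (n : ℕ) → A → A → Word2 A 3 n
aba n a b Fin.zero _ = a
aba n a b (Fin.suc Fin.zero) _ = b
aba n a b (Fin.suc (Fin.suc Fin.zero)) _ = a

-- The third row of a 3-row HV-palindrome equals the first, so the word is given by two rows u
-- and v. An HV-palindromic factor of height 1 is a palindrome of u or of v; one of height 2 has
-- two equal rows, so it is a palindrome occurring in u and in v at the same place; one of height 3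
-- is a palindrome of the word of columns (u x , v x). A word of length n has at most n distinct
-- non-empty palindromes: charge each to the end of its first occurrence; no position is charged
-- twice, since of two palindromic suffixes the shorter is also a prefix of the longer one and so
-- occurs earlier. Charging a palindrome of both u and v to u in height 1 and to v in height 2, the
-- heights 1 and 2 contribute at most n + n and height 3 at most n. For the rows a^n, b^n, a^n the
-- factors a^q and b^q (height 1) and the full-height blocks (height 3) give 3n.

module Submission where

open import Defs
open import Data.Empty using (⊥-elim)
open import Function.Base using (_∋_)
open import Data.Fin using (Fin; toℕ; fromℕ<; opposite)
open import Data.Fin.Patterns using (0F; 1F; 2F)
open import Data.Fin.Properties using (toℕ<n; toℕ-fromℕ<; fromℕ<-toℕ; opposite-prop; all?; any?)
  renaming (_≟_ to _≟ᶠ_)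
open import Data.List using (List; []; _∷_; [_]; _++_; length; map; filter; deduplicate; upTo)
open import Data.List.Membership.Propositional using (_∈_; _─_; find; lose)
open import Data.List.Membership.Propositional.Properties
  using (∈-filter⁺; ∈-filter⁻; ∈-upTo⁺; ∈-upTo⁻; ∈-map⁺; ∈-map⁻; ∈-concatMap⁺; ∈-concatMap⁻
        ; ∈-++⁺ˡ; ∈-++⁺ʳ)
open import Data.List.Properties using (length-++; length-map; length-removeAt′; filter-++; length-upTo; map-cong)
open import Data.List.Relation.Unary.All as All using (All; []; _∷_)
import Data.List.Relation.Unary.All.Properties as All
open import Data.List.Relation.Unary.AllPairs using (AllPairs; []; _∷_)
import Data.List.Relation.Unary.AllPairs.Properties as AllPairs
open import Data.List.Relation.Unary.Any using (here; there; index)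
import Data.List.Relation.Unary.Any.Properties as Any
open import Data.List.Relation.Unary.Unique.Propositional using (Unique)
open import Data.List.Relation.Unary.Unique.Propositional.Properties using (upTo⁺)
open import Data.Nat using (ℕ; suc; _+_; _*_; _∸_; _≤_; _<_; z≤n; s≤s)
open import Data.Nat.Induction using (<-wellFounded)
open import Data.Nat.ListAction using (sum)
open import Data.Nat.Properties
open import Data.Product using (Σ; ∃-syntax; _×_; _,_; _,′_; proj₁; proj₂)
open import Data.Product.Properties using (≡-dec)
open import Data.Sum using (_⊎_; inj₁; inj₂)
import Data.Sum as Sum
open import Induction.WellFounded using (Acc; acc)
open import Relation.Binary using (DecidableEquality; Tri)
import Relation.Binary as B
open import Relation.Binary.PropositionalEquality
  using (_≡_; _≢_; refl; sym; trans; cong; cong₂; subst; _≗_; module ≡-Reasoning)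
open import Relation.Nullary using (¬_; Dec; yes; no; ¬?; _×-dec_)
open import Relation.Unary using (Decidable)
open import Relation.Unary.Properties using (∁?)

open import Algebra.Properties.CommutativeSemigroup +-commutativeSemigroup using (interchange)

module _ {X : Set} where

  ∈-─⁻ : {c c′ : X} {C : List X} (c∈C : c ∈ C) → c′ ∈ C → c′ ≡ c ⊎ c′ ∈ C ─ c∈C
  ∈-─⁻ (here refl) (here refl) = inj₁ refl
  ∈-─⁻ (here refl) (there c′∈C) = inj₂ c′∈C
  ∈-─⁻ (there c∈C) (here refl) = inj₂ (here refl)
  ∈-─⁻ (there c∈C) (there c′∈C) = Sum.map₂ there (∈-─⁻ c∈C c′∈C)

  deduplicate-distinct : {R : X → X → Set} (R? : B.Decidable R) (xs : List X) →
    AllPairs (λ x y → ¬ R x y) (deduplicate R? xs)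
  deduplicate-distinct R? [] = []
  deduplicate-distinct R? (x ∷ xs) =
    All.all-filter (λ y → ¬? (R? x y)) (deduplicate R? xs)
      ∷ AllPairs.filter⁺ (λ y → ¬? (R? x y)) (deduplicate-distinct R? xs)

  length-filter-∁+length-filter : {P : X → Set} (P? : Decidable P) (xs : List X) →
    length (filter (∁? P?) xs) + length (filter P? xs) ≡ length xs
  length-filter-∁+length-filter P? [] = refl
  length-filter-∁+length-filter P? (x ∷ xs) with P? x
  ... | yes _ = trans (+-suc _ _) (cong suc (length-filter-∁+length-filter P? xs))
  ... | no _ = cong suc (length-filter-∁+length-filter P? xs)

  sum-map-+ : (f g : X → ℕ) (xs : List X) →
    sum (map (λ x → f x + g x) xs) ≡ sum (map f xs) + sum (map g xs)
  sum-map-+ f g [] = refl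
  sum-map-+ f g (x ∷ xs) =
    trans (cong (f x + g x +_) (sum-map-+ f g xs)) (interchange (f x) (g x) _ _)

  sum-map-mono-≤ : {f g : X → ℕ} (xs : List X) → (∀ {x} → x ∈ xs → f x ≤ g x) →
    sum (map f xs) ≤ sum (map g xs)
  sum-map-mono-≤ [] f≤g = z≤n
  sum-map-mono-≤ (x ∷ xs) f≤g = +-mono-≤ (f≤g (here refl)) (sum-map-mono-≤ xs (λ x∈xs → f≤g (there x∈xs)))

  sum-map-const : (c : ℕ) (xs : List X) → sum (map (λ _ → c) xs) ≡ c * length xs
  sum-map-const c [] = sym (*-zeroʳ c)
  sum-map-const c (x ∷ xs) = trans (cong (c +_) (sum-map-const c xs)) (sym (*-suc c (length xs)))

module _ {X Y : Set} where

  length-≤-of-cover : {_≈_ : X → X → Set} {R : X → Y → Set} →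
    (∀ {x y c} → R x c → R y c → x ≈ y) →
    {D : List X} → AllPairs (λ x y → ¬ x ≈ y) D →
    (C : List Y) → (∀ {x} → x ∈ D → ∃[ c ] c ∈ C × R x c) → length D ≤ length C
  length-≤-of-cover R-unique [] C cover = z≤n
  length-≤-of-cover {R = R} R-unique {x ∷ D} (x≉D ∷ D-distinct) C cover with cover (here refl)
  ... | c , c∈C , Rxc =
    subst (suc (length D) ≤_) (sym (length-removeAt′ C (index c∈C)))
      (s≤s (length-≤-of-cover R-unique D-distinct (C ─ c∈C) cover′))
    where
    cover′ : ∀ {y} → y ∈ D → ∃[ c′ ] c′ ∈ C ─ c∈C × R y c′
    cover′ y∈D with cover (there y∈D)
    ... | c′ , c′∈C , Ryc′ with ∈-─⁻ c∈C c′∈C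
    ...   | inj₁ refl = ⊥-elim (All.lookup x≉D y∈D (R-unique Rxc Ryc′))
    ...   | inj₂ c′∈C─c = c′ , c′∈C─c , Ryc′

  -- Double counting by e, which is related to at most one q.
  sum-length-filter-≤ : {P : X → Y → Set} (P? : ∀ q → Decidable (P q)) →
    (∀ {q q′ e} → P q e → P q′ e → q ≡ q′) →
    {Q : List X} → Unique Q → (E : List Y) →
    sum (map (λ q → length (filter (P? q) E)) Q) ≤ length E
  sum-length-filter-≤ P? P-functional {Q} Q-unique = go
    where
    at-most-one : ∀ e {Q′} → Unique Q′ → sum (map (λ q → length (filter (P? q) [ e ])) Q′) ≤ 1
    at-most-one e [] = z≤n
    at-most-one e {q ∷ Q′} (q∉Q′ ∷ Q′-unique) with P? q e
    ... | no _ = at-most-one e Q′-unique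
    ... | yes Pqe = s≤s (≤-reflexive (none Q′ q∉Q′))
      where
      none : ∀ Q″ → All (q ≢_) Q″ → sum (map (λ q′ → length (filter (P? q′) [ e ])) Q″) ≡ 0
      none [] [] = refl
      none (q′ ∷ Q″) (q≢q′ ∷ q∉Q″) with P? q′ e
      ... | yes Pq′e = ⊥-elim (q≢q′ (P-functional Pqe Pq′e))
      ... | no _ = none Q″ q∉Q″

    go : ∀ E → sum (map (λ q → length (filter (P? q) E)) Q) ≤ length E
    go [] = ≤-reflexive (trans (sum-map-const 0 Q) (*-zeroˡ (length Q)))
    go (e ∷ E) = begin
      sum (map (λ q → length (filter (P? q) (e ∷ E))) Q)
        ≡⟨ cong sum (map-cong split Q) ⟩
      sum (map (λ q → length (filter (P? q) [ e ]) + length (filter (P? q) E)) Q)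
        ≡⟨ sum-map-+ _ _ Q ⟩
      sum (map (λ q → length (filter (P? q) [ e ])) Q) + sum (map (λ q → length (filter (P? q) E)) Q)
        ≤⟨ +-mono-≤ (at-most-one e Q-unique) (go E) ⟩
      suc (length E) ∎
      where
      open ≤-Reasoning
      split : ∀ q → length (filter (P? q) (e ∷ E)) ≡ length (filter (P? q) [ e ]) + length (filter (P? q) E)
      split q = trans (cong length (filter-++ (P? q) [ e ] E)) (length-++ (filter (P? q) [ e ]))

module _ {B : Set} where

  factor : (ℕ → B) → ℕ → (q : ℕ) → Fin (suc q) → B
  factor x i q s = x (i + toℕ s)

  factor-cong : {x y : ℕ → B} → x ≗ y → ∀ i q → factor x i q ≗ factor y i q
  factor-cong x≗y i q s = x≗y (i + toℕ s)

  IsPalindrome-resp-≗ : {n : ℕ} {f g : Fin n → B} → f ≗ g → IsPalindrome g → IsPalindrome f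
  IsPalindrome-resp-≗ f≗g g-pal j = trans (f≗g j) (trans (g-pal j) (sym (f≗g (opposite j))))

  palindrome-mirror : (x : ℕ → B) (i q : ℕ) {s : ℕ} → IsPalindrome (factor x i q) → s ≤ q →
    x (i + s) ≡ x (i + (q ∸ s))
  palindrome-mirror x i q {s} pal s≤q = begin
    x (i + s)                ≡⟨ cong (λ t → x (i + t)) (sym (toℕ-fromℕ< (s≤s s≤q))) ⟩
    x (i + toℕ t)            ≡⟨ pal t ⟩
    x (i + toℕ (opposite t)) ≡⟨ cong (λ t′ → x (i + t′)) (trans (opposite-prop t) (cong (q ∸_) (toℕ-fromℕ< (s≤s s≤q))))
                              ⟩
    x (i + (q ∸ s))          ∎
    where
    open ≡-Reasoning
    t : Fin (suc q)
    t = fromℕ< (s≤s s≤q)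

  -- f occurs in x with its last letter at a position < N.
  OccursBefore : {q : ℕ} → (ℕ → B) → ℕ → (Fin (suc q) → B) → Set
  OccursBefore {q} x N f = ∃[ e ] q ≤ toℕ {N} e × factor x (toℕ e ∸ q) q ≗ f

  OccursBefore-resp-≗ : {q N : ℕ} {x : ℕ → B} {f g : Fin (suc q) → B} →
    f ≗ g → OccursBefore x N f → OccursBefore x N g
  OccursBefore-resp-≗ f≗g (e , q≤e , occ≗f) = e , q≤e , λ s → trans (occ≗f s) (f≗g s)

  factor-occursBefore : (x : ℕ → B) {j q N : ℕ} → j + q < N → OccursBefore x N (factor x j q)
  factor-occursBefore x {j} {q} j+q<N =
    fromℕ< j+q<N , subst (q ≤_) (sym (toℕ-fromℕ< j+q<N)) (m≤n+m q j) ,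
    λ s → cong (λ i → x (i + toℕ s)) (trans (cong (_∸ q) (toℕ-fromℕ< j+q<N)) (m+n∸n≡m j q))

  NewPalindromeAt : (ℕ → B) → ℕ → ℕ → Set
  NewPalindromeAt x e q =
    q ≤ e × IsPalindrome (factor x (e ∸ q) q) × ¬ OccursBefore x e (factor x (e ∸ q) q)

  shorter-palindromic-suffix-occursBefore : (x : ℕ → B) {a b e : ℕ} → b < a → a ≤ e →
    IsPalindrome (factor x (e ∸ a) a) → IsPalindrome (factor x (e ∸ b) b) →
    OccursBefore x e (factor x (e ∸ b) b)
  shorter-palindromic-suffix-occursBefore x {a} {b} {e} b<a a≤e a-pal b-pal =
    OccursBefore-resp-≗ {x = x} same (factor-occursBefore x e∸a+b<e)
    where
    e∸a+b<e : e ∸ a + b < e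
    e∸a+b<e = subst (e ∸ a + b <_) (m∸n+n≡m a≤e) (+-monoʳ-< (e ∸ a) b<a)
    ∸-split : ∀ {t s} → t ≤ e → s ≤ t → e ∸ t + (t ∸ s) ≡ e ∸ s
    ∸-split {t} {s} t≤e s≤t = trans (sym (+-∸-assoc (e ∸ t) s≤t)) (cong (_∸ s) (m∸n+n≡m t≤e))
    same : factor x (e ∸ a) b ≗ factor x (e ∸ b) b
    same s = begin
      x (e ∸ a + toℕ s)         ≡⟨ palindrome-mirror x (e ∸ a) a a-pal s≤a ⟩
      x (e ∸ a + (a ∸ toℕ s))   ≡⟨ cong x (∸-split a≤e s≤a) ⟩
      x (e ∸ toℕ s)             ≡⟨ cong x (sym (∸-split (≤-trans (<⇒≤ b<a) a≤e) s≤b)) ⟩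
      x (e ∸ b + (b ∸ toℕ s))   ≡⟨ sym (palindrome-mirror x (e ∸ b) b b-pal s≤b) ⟩
      x (e ∸ b + toℕ s)         ∎
      where
      open ≡-Reasoning
      s≤b : toℕ s ≤ b
      s≤b = ≤-pred (toℕ<n s)
      s≤a : toℕ s ≤ a
      s≤a = ≤-trans s≤b (<⇒≤ b<a)

  NewPalindromeAt-unique : (x : ℕ → B) {e a b : ℕ} → NewPalindromeAt x e a → NewPalindromeAt x e b → a ≡ b
  NewPalindromeAt-unique x {a = a} {b} (a≤e , a-pal , a-new) (b≤e , b-pal , b-new) with <-cmp a b
  ... | Tri.tri< a<b _ _ = ⊥-elim (a-new (shorter-palindromic-suffix-occursBefore x a<b b≤e b-pal a-pal))
  ... | Tri.tri≈ _ a≡b _ = a≡b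
  ... | Tri.tri> _ _ b<a = ⊥-elim (b-new (shorter-palindromic-suffix-occursBefore x b<a a≤e a-pal b-pal))

module Palindromes {B : Set} (_≟_ : DecidableEquality B) where

  isPalindrome? : {n : ℕ} (f : Fin n → B) → Dec (IsPalindrome f)
  isPalindrome? f = all? (λ j → f j ≟ f (opposite j))

  occursBefore? : {q : ℕ} (x : ℕ → B) (N : ℕ) (f : Fin (suc q) → B) → Dec (OccursBefore x N f)
  occursBefore? {q} x N f =
    any? (λ e → (q ≤? toℕ e) ×-dec all? (λ s → factor x (toℕ e ∸ q) q s ≟ f s))

  newPalindromeAt? : (x : ℕ → B) (e q : ℕ) → Dec (NewPalindromeAt x e q)
  newPalindromeAt? x e q =
    (q ≤? e) ×-dec isPalindrome? (factor x (e ∸ q) q) ×-dec ¬? (occursBefore? x e (factor x (e ∸ q) q))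

  -- Descend to the earliest occurrence; there the palindrome is new.
  first-occurrence : (x : ℕ → B) {N q : ℕ} {f : Fin (suc q) → B} → IsPalindrome f → OccursBefore x N f →
    ∃[ e ] e < N × NewPalindromeAt x e q × factor x (e ∸ q) q ≗ f
  first-occurrence x {q = q} {f} f-pal = go (<-wellFounded _)
    where
    go : ∀ {N} → Acc _<_ N → OccursBefore x N f → ∃[ e ] e < N × NewPalindromeAt x e q × factor x (e ∸ q) q ≗ f
    go (acc earlier) (e , q≤e , occ≗f) with occursBefore? x (toℕ e) (factor x (toℕ e ∸ q) q)
    ... | no new = toℕ e , toℕ<n e , (q≤e , IsPalindrome-resp-≗ occ≗f f-pal , new) , occ≗f
    ... | yes occ with go (earlier (toℕ<n e)) (OccursBefore-resp-≗ {x = x} occ≗f occ)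
    ...   | e′ , e′<e , e′-new , occ′≗f = e′ , <-trans e′<e (toℕ<n e) , e′-new , occ′≗f

  newPalindromeEnds : (ℕ → B) → ℕ → ℕ → List ℕ
  newPalindromeEnds x n q = filter (λ e → newPalindromeAt? x e q) (upTo n)

  newPalindromeEnd-of-occurrence : (x : ℕ → B) {n q : ℕ} {f : Fin (suc q) → B} →
    IsPalindrome f → OccursBefore x n f → ∃[ e ] e ∈ newPalindromeEnds x n q × factor x (e ∸ q) q ≗ f
  newPalindromeEnd-of-occurrence x {n} {q} f-pal occ with first-occurrence x f-pal occ
  ... | e , e<n , e-new , occ≗f = e , ∈-filter⁺ (λ e → newPalindromeAt? x e q) (∈-upTo⁺ e<n) e-new , occ≗f

  sum-length-newPalindromeEnds-≤ : (x : ℕ → B) (n : ℕ) →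
    sum (map (λ q → length (newPalindromeEnds x n q)) (upTo n)) ≤ n
  sum-length-newPalindromeEnds-≤ x n =
    ≤-trans (sum-length-filter-≤ (λ q e → newPalindromeAt? x e q) (NewPalindromeAt-unique x) (upTo⁺ n) (upTo n))
            (≤-reflexive (length-upTo n))

module _ {m : ℕ} where

  ∈-placements⁻ : {p : ℕ} {g : Fin p → Fin m} → g ∈ placements m p →
    ∃[ i ] Σ (i + p ≤ m) λ h → g ≡ shift m p i h
  ∈-placements⁻ {p} g∈ with find (∈-concatMap⁻ _ {xs = upTo m} g∈)
  ... | i , _ , g∈one with i + p ≤? m | g∈one
  ...   | yes h | here g≡shift = i , h , g≡shift
  ...   | no _  | ()

  ∈-placements⁺ : {p i : ℕ} (h : i + p ≤ m) → i < m → shift m p i h ∈ placements m p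
  ∈-placements⁺ {p} {i} h i<m
    with (_ → shift m p i h ∈ placements m p) ∋ (λ g∈one → ∈-concatMap⁺ _ (lose (∈-upTo⁺ i<m) g∈one))
  ... | via-one with i + p ≤? m
  ...   | yes _ = via-one (here refl)
  ...   | no i+p≰m = ⊥-elim (i+p≰m h)

module _ {A : Set} {m n : ℕ} where

  ∈-factorsOfSize⁻ : {p q : ℕ} {w : Word2 A m n} {F : Word2 A p q} → F ∈ factorsOfSize p q w →
    ∃[ i ] Σ (i + p ≤ m) λ h → ∃[ j ] Σ (j + q ≤ n) λ h′ →
      F ≡ (λ r s → w (shift m p i h r) (shift n q j h′ s))
  ∈-factorsOfSize⁻ {p} F∈ with find (∈-concatMap⁻ _ {xs = placements m p} F∈)
  ... | f , f∈ , F∈map with ∈-map⁻ _ F∈map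
  ...   | g , g∈ , refl with ∈-placements⁻ f∈ | ∈-placements⁻ g∈
  ...     | i , h , refl | j , h′ , refl = i , h , j , h′ , refl

  ∈-factorsOfSize⁺ : {p q i j : ℕ} (w : Word2 A m n) (h : i + p ≤ m) (h′ : j + q ≤ n) → i < m → j < n →
    (λ r s → w (shift m p i h r) (shift n q j h′ s)) ∈ factorsOfSize p q w
  ∈-factorsOfSize⁺ w h h′ i<m j<n =
    ∈-concatMap⁺ _ (lose (∈-placements⁺ h i<m) (∈-map⁺ _ (∈-placements⁺ h′ j<n)))

module _ {k m n : ℕ} (w : Word2 (Fin k) m n) where

  hvPalFactors : (p q : ℕ) → List (Word2 (Fin k) p q)
  hvPalFactors p q = deduplicate _≈₂?_ (filter isHVPal? (factorsOfSize p q w))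

  hvPalFactorsOfSize-≤ : {Y : Set} {p q : ℕ} (decode : Y → Word2 (Fin k) p q) (C : List Y) →
    (∀ {F} → F ∈ factorsOfSize p q w → IsHVPal F → ∃[ c ] c ∈ C × F ≈₂ decode c) →
    hvPalFactorsOfSize p q w ≤ length C
  hvPalFactorsOfSize-≤ {p = p} {q} decode C cover =
    length-≤-of-cover {R = λ F c → F ≈₂ decode c} (λ F≈c G≈c r s → trans (F≈c r s) (sym (G≈c r s)))
      (deduplicate-distinct {R = _≈₂_} _≈₂?_ (filter isHVPal? (factorsOfSize p q w))) C covered
    where
    covered : ∀ {F} → F ∈ hvPalFactors p q → ∃[ c ] c ∈ C × F ≈₂ decode c
    covered F∈ with ∈-filter⁻ isHVPal? (Any.deduplicate⁻ _≈₂?_ F∈)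
    ... | F∈factors , F-hv = cover F∈factors F-hv

  length-≤-hvPalFactorsOfSize : {p q : ℕ} (Fs : List (Word2 (Fin k) p q)) →
    AllPairs (λ F G → ¬ F ≈₂ G) Fs → (∀ {F} → F ∈ Fs → F ∈ factorsOfSize p q w × IsHVPal F) →
    length Fs ≤ hvPalFactorsOfSize p q w
  length-≤-hvPalFactorsOfSize {p} {q} Fs Fs-distinct Fs⊆ =
    length-≤-of-cover {R = λ F G → G ≈₂ F} (λ G≈F G≈F′ r s → trans (sym (G≈F r s)) (G≈F′ r s))
      Fs-distinct (hvPalFactors p q) represented
    where
    represented : ∀ {F} → F ∈ Fs → ∃[ G ] G ∈ hvPalFactors p q × G ≈₂ F
    represented F∈Fs with Fs⊆ F∈Fs
    ... | F∈factors , F-hv =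
      find (Any.deduplicate⁺ _≈₂?_ (λ G≈G′ G′≈F r s → trans (G≈G′ r s) (G′≈F r s))
              (lose (∈-filter⁺ isHVPal? F∈factors F-hv) (λ r s → refl)))

hvPalFactorsOfHeight : {k m n : ℕ} → ℕ → Word2 (Fin k) m n → ℕ
hvPalFactorsOfHeight {n = n} p w = sum (map (λ q → hvPalFactorsOfSize p (suc q) w) (upTo n))

numHVPalFactors-height3 : {k n : ℕ} (w : Word2 (Fin k) 3 n) →
  numHVPalFactors w ≡ hvPalFactorsOfHeight 1 w + hvPalFactorsOfHeight 2 w + hvPalFactorsOfHeight 3 w
numHVPalFactors-height3 w =
  trans (sym (+-assoc h₁ h₂ (h₃ + 0))) (cong (h₁ + h₂ +_) (+-identityʳ h₃))
  where
  h₁ h₂ h₃ : ℕ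
  h₁ = hvPalFactorsOfHeight 1 w
  h₂ = hvPalFactorsOfHeight 2 w
  h₃ = hvPalFactorsOfHeight 3 w

-- Positions past the end read the first letter (a junk value).
extend : {A : Set} {n : ℕ} → (Fin (suc n) → A) → ℕ → A
extend {n = n} f x with x <? suc n
... | yes x<n = f (fromℕ< x<n)
... | no _ = f 0F

extend-toℕ : {A : Set} {n : ℕ} (f : Fin (suc n) → A) (c : Fin (suc n)) → extend f (toℕ c) ≡ f c
extend-toℕ {n = n} f c with toℕ c <? suc n
... | yes c<n = cong f (fromℕ<-toℕ c c<n)
... | no c≮n = ⊥-elim (c≮n (toℕ<n c))

extend-cong : {A : Set} {n : ℕ} {f g : Fin (suc n) → A} → f ≗ g → extend f ≗ extend g
extend-cong {n = n} f≗g x with x <? suc n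
... | yes _ = f≗g _
... | no _ = f≗g 0F

module ThreeRows {k n : ℕ} (w : Word2 (Fin k) 3 (suc n)) (w-hv : IsHVPal w) where

  open Palindromes (_≟ᶠ_ {k})
  module Pairs = Palindromes (≡-dec (_≟ᶠ_ {k}) (_≟ᶠ_ {k}))

  N : ℕ
  N = suc n

  rows : Fin 3 → ℕ → Fin k
  rows r = extend (w r)

  u v : ℕ → Fin k
  u = rows 0F
  v = rows 1F

  rows-2≗u : rows 2F ≗ u
  rows-2≗u = extend-cong (λ c → sym (proj₂ w-hv c 0F))

  rows-≗ : ∀ ρ → rows ρ ≗ u ⊎ rows ρ ≗ v
  rows-≗ 0F = inj₁ (λ _ → refl)
  rows-≗ 1F = inj₂ (λ _ → refl)
  rows-≗ 2F = inj₁ rows-2≗u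

  ∈-factorsOfSize⇒rows : {p q : ℕ} {F : Word2 (Fin k) p (suc q)} → F ∈ factorsOfSize p (suc q) w →
    ∃[ i ] Σ (i + p ≤ 3) λ h → ∃[ j ] j + q < N × ∀ r → F r ≗ factor (rows (shift 3 p i h r)) j q
  ∈-factorsOfSize⇒rows {p} {q} F∈ with ∈-factorsOfSize⁻ {w = w} F∈
  ... | i , h , j , h′ , refl = i , h , j , subst (_≤ N) (+-suc j q) h′ , λ r s →
    let c = shift N (suc q) j h′ s
    in trans (sym (extend-toℕ (w (shift 3 p i h r)) c)) (cong (rows (shift 3 p i h r)) (toℕ-fromℕ< {j + toℕ s} _))

  newPalindromeEnd-of-factor : (x : ℕ → Fin k) {j q : ℕ} → IsPalindrome (factor x j q) → j + q < N →
    ∃[ e ] e ∈ newPalindromeEnds x N q × factor x (e ∸ q) q ≗ factor x j q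
  newPalindromeEnd-of-factor x pal j+q<N = newPalindromeEnd-of-occurrence x pal (factor-occursBefore x j+q<N)

  occursInU? : (q e : ℕ) → Dec (OccursBefore u N (factor v (e ∸ q) q))
  occursInU? q e = occursBefore? u N (factor v (e ∸ q) q)

  codes₁ : ℕ → List ((ℕ → Fin k) × ℕ)
  codes₁ q = map (u ,′_) (newPalindromeEnds u N q)
          ++ map (v ,′_) (filter (∁? (occursInU? q)) (newPalindromeEnds v N q))

  codes₂ : ℕ → List ℕ
  codes₂ q = filter (occursInU? q) (newPalindromeEnds v N q)

  decode₁ : {q : ℕ} → (ℕ → Fin k) × ℕ → Word2 (Fin k) 1 (suc q)
  decode₁ {q} (x , e) _ = factor x (e ∸ q) q

  decode₂ : {q : ℕ} → ℕ → Word2 (Fin k) 2 (suc q)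
  decode₂ {q} e _ = factor v (e ∸ q) q

  oneRow⇒factor : ∀ {q F} → F ∈ factorsOfSize 1 (suc q) w →
    ∃[ j ] j + q < N × (F 0F ≗ factor u j q ⊎ F 0F ≗ factor v j q)
  oneRow⇒factor {q} {F} F∈ with ∈-factorsOfSize⇒rows F∈
  ... | i , h , j , j+q<N , F≗ =
    j , j+q<N , Sum.map (via-row (F≗ 0F)) (via-row (F≗ 0F)) (rows-≗ (shift 3 1 i h 0F))
    where
    via-row : ∀ {y z} → F 0F ≗ factor y j q → y ≗ z → F 0F ≗ factor z j q
    via-row F≗y y≗z s = trans (F≗y s) (factor-cong y≗z j q s)

  cover₁ : ∀ {q F} → F ∈ factorsOfSize 1 (suc q) w → IsHVPal F → ∃[ c ] c ∈ codes₁ q × F ≈₂ decode₁ c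
  cover₁ {q} {F} F∈ F-hv with oneRow⇒factor F∈
  ... | j , j+q<N , F-in = Sum.[ in-u , in-v ] F-in
    where
    F-pal : ∀ x → F 0F ≗ factor x j q → IsPalindrome (factor x j q)
    F-pal x F≗x = IsPalindrome-resp-≗ (λ s → sym (F≗x s)) (proj₁ F-hv 0F)

    from-u : ∀ {e} → e ∈ newPalindromeEnds u N q → F 0F ≗ factor u (e ∸ q) q →
      ∃[ c ] c ∈ codes₁ q × F ≈₂ decode₁ c
    from-u {e} e∈ F≗u = (u , e) , ∈-++⁺ˡ (∈-map⁺ (u ,′_) e∈) , λ { 0F → F≗u }

    in-u : F 0F ≗ factor u j q → ∃[ c ] c ∈ codes₁ q × F ≈₂ decode₁ c
    in-u F≗u with newPalindromeEnd-of-factor u (F-pal u F≗u) j+q<N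
    ... | e , e∈ , occ≗ = from-u e∈ (λ s → trans (F≗u s) (sym (occ≗ s)))

    in-v : F 0F ≗ factor v j q → ∃[ c ] c ∈ codes₁ q × F ≈₂ decode₁ c
    in-v F≗v with newPalindromeEnd-of-factor v (F-pal v F≗v) j+q<N
    ... | e , e∈ , occ≗ with occursInU? q e
    ...   | no ∉u = (v , e) , ∈-++⁺ʳ _ (∈-map⁺ (v ,′_) (∈-filter⁺ (∁? (occursInU? q)) e∈ ∉u)) ,
                    λ { 0F s → trans (F≗v s) (sym (occ≗ s)) }
    ...   | yes ∈u with newPalindromeEnd-of-occurrence u (IsPalindrome-resp-≗ occ≗ (F-pal v F≗v)) ∈u
    ...     | e′ , e′∈ , occ′≗ = from-u e′∈ (λ s → trans (F≗v s) (sym (trans (occ′≗ s) (occ≗ s))))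

  twoRows⇒factor : ∀ {q F} → F ∈ factorsOfSize 2 (suc q) w → IsHVPal F →
    ∃[ j ] j + q < N × (∀ r → F r ≗ factor v j q) × factor u j q ≗ factor v j q
  twoRows⇒factor {q} {F} F∈ (_ , F-cols) with ∈-factorsOfSize⇒rows F∈
  ... | 0 , _ , j , j+q<N , F≗ =
    j , j+q<N , (λ { 0F s → trans (F-cols s 0F) (F≗ 1F s) ; 1F → F≗ 1F }) ,
    λ s → trans (sym (F≗ 0F s)) (trans (F-cols s 0F) (F≗ 1F s))
  ... | 1 , _ , j , j+q<N , F≗ =
    j , j+q<N , (λ { 0F → F≗ 0F ; 1F s → trans (sym (F-cols s 0F)) (F≗ 0F s) }) ,
    λ s → trans (sym (trans (F≗ 1F s) (rows-2≗u (j + toℕ s)))) (trans (sym (F-cols s 0F)) (F≗ 0F s))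
  ... | suc (suc i) , i+2≤3 , _ with +-cancelʳ-≤ 2 (suc (suc i)) 1 i+2≤3
  ...   | s≤s ()

  cover₂ : ∀ {q F} → F ∈ factorsOfSize 2 (suc q) w → IsHVPal F → ∃[ e ] e ∈ codes₂ q × F ≈₂ decode₂ e
  cover₂ {q} {F} F∈ F-hv with twoRows⇒factor F∈ F-hv
  ... | j , j+q<N , F≗v , u≗v = from-v (newPalindromeEnd-of-factor v v-pal j+q<N)
    where
    v-pal : IsPalindrome (factor v j q)
    v-pal = IsPalindrome-resp-≗ (λ s → sym (F≗v 0F s)) (proj₁ F-hv 0F)

    from-v : ∃[ e ] e ∈ newPalindromeEnds v N q × factor v (e ∸ q) q ≗ factor v j q →
      ∃[ e ] e ∈ codes₂ q × F ≈₂ decode₂ e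
    from-v (e , e∈ , occ≗) =
      e , ∈-filter⁺ (occursInU? q) e∈ (OccursBefore-resp-≗ {x = u} u≗occ (factor-occursBefore u j+q<N)) ,
      λ r s → trans (F≗v r s) (sym (occ≗ s))
      where
      u≗occ : factor u j q ≗ factor v (e ∸ q) q
      u≗occ s = trans (u≗v s) (sym (occ≗ s))

  threeRows⇒factor : ∀ {q F} → F ∈ factorsOfSize 3 (suc q) w →
    ∃[ j ] j + q < N × ∀ r → F r ≗ factor (rows r) j q
  threeRows⇒factor F∈ with ∈-factorsOfSize⇒rows F∈
  ... | 0 , _ , j , j+q<N , F≗ = j , j+q<N , λ { 0F → F≗ 0F ; 1F → F≗ 1F ; 2F → F≗ 2F }
  ... | suc i , i+3≤3 , _ with +-cancelʳ-≤ 3 (suc i) 0 i+3≤3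
  ...   | ()

  uv : ℕ → Fin k × Fin k
  uv x = u x , v x

  decode₃ : {q : ℕ} → ℕ → Word2 (Fin k) 3 (suc q)
  decode₃ {q} e r = factor (rows r) (e ∸ q) q

  cover₃ : ∀ {q F} → F ∈ factorsOfSize 3 (suc q) w → IsHVPal F →
    ∃[ e ] e ∈ Pairs.newPalindromeEnds uv N q × F ≈₂ decode₃ e
  cover₃ {q} {F} F∈ (F-rows , _) with threeRows⇒factor F∈
  ... | j , j+q<N , F≗ = from-uv (Pairs.newPalindromeEnd-of-occurrence uv uv-pal (factor-occursBefore uv j+q<N))
    where
    row-pal : ∀ r → IsPalindrome (factor (rows r) j q)
    row-pal r = IsPalindrome-resp-≗ (λ s → sym (F≗ r s)) (F-rows r)

    uv-pal : IsPalindrome (factor uv j q)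
    uv-pal s = cong₂ _,_ (row-pal 0F s) (row-pal 1F s)

    from-uv : ∃[ e ] e ∈ Pairs.newPalindromeEnds uv N q × factor uv (e ∸ q) q ≗ factor uv j q →
      ∃[ e ] e ∈ Pairs.newPalindromeEnds uv N q × F ≈₂ decode₃ e
    from-uv (e , e∈ , occ≗) = e , e∈ , λ r s → trans (F≗ r s) (sym (rows-occ≗ r s))
      where
      rows-occ≗ : ∀ r → factor (rows r) (e ∸ q) q ≗ factor (rows r) j q
      rows-occ≗ 0F s = cong proj₁ (occ≗ s)
      rows-occ≗ 1F s = cong proj₂ (occ≗ s)
      rows-occ≗ 2F s =
        trans (rows-2≗u (e ∸ q + toℕ s)) (trans (cong proj₁ (occ≗ s)) (sym (rows-2≗u (j + toℕ s))))

  height-1+2-≤ : ∀ q → hvPalFactorsOfSize 1 (suc q) w + hvPalFactorsOfSize 2 (suc q) w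
                     ≤ length (newPalindromeEnds u N q) + length (newPalindromeEnds v N q)
  height-1+2-≤ q = begin
    hvPalFactorsOfSize 1 (suc q) w + hvPalFactorsOfSize 2 (suc q) w
      ≤⟨ +-mono-≤ (hvPalFactorsOfSize-≤ w decode₁ (codes₁ q) (cover₁ {q}))
                  (hvPalFactorsOfSize-≤ w decode₂ (codes₂ q) (cover₂ {q})) ⟩
    length (codes₁ q) + length (codes₂ q)
      ≡⟨ cong (_+ length (codes₂ q)) (trans (length-++ (map (u ,′_) U))
           (cong₂ _+_ (length-map (u ,′_) U) (length-map (v ,′_) (filter (∁? (occursInU? q)) V)))) ⟩
    length U + length (filter (∁? (occursInU? q)) V) + length (filter (occursInU? q) V)
      ≡⟨ +-assoc (length U) _ _ ⟩
    length U + (length (filter (∁? (occursInU? q)) V) + length (filter (occursInU? q) V))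
      ≡⟨ cong (length U +_) (length-filter-∁+length-filter (occursInU? q) V) ⟩
    length U + length V ∎
    where
    open ≤-Reasoning
    U V : List ℕ
    U = newPalindromeEnds u N q
    V = newPalindromeEnds v N q

  numHVPalFactors-≤ : numHVPalFactors w ≤ 3 * N
  numHVPalFactors-≤ = begin
    numHVPalFactors w
      ≡⟨ numHVPalFactors-height3 w ⟩
    hvPalFactorsOfHeight 1 w + hvPalFactorsOfHeight 2 w + hvPalFactorsOfHeight 3 w
      ≡⟨ cong (_+ hvPalFactorsOfHeight 3 w) (sym (sum-map-+ (height 1) (height 2) (upTo N))) ⟩
    sum (map (λ q → height 1 q + height 2 q) (upTo N)) + hvPalFactorsOfHeight 3 w
      ≤⟨ +-mono-≤ (sum-map-mono-≤ (upTo N) (λ {q} _ → height-1+2-≤ q))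
                  (sum-map-mono-≤ (upTo N) (λ {q} _ → hvPalFactorsOfSize-≤ w decode₃ _ (cover₃ {q}))) ⟩
    sum (map (λ q → #ends u q + #ends v q) (upTo N)) + #uvEnds
      ≡⟨ cong (_+ #uvEnds) (sum-map-+ (#ends u) (#ends v) (upTo N)) ⟩
    sum (map (#ends u) (upTo N)) + sum (map (#ends v) (upTo N)) + #uvEnds
      ≤⟨ +-mono-≤ (+-mono-≤ (sum-length-newPalindromeEnds-≤ u N) (sum-length-newPalindromeEnds-≤ v N))
                  (Pairs.sum-length-newPalindromeEnds-≤ uv N) ⟩
    N + N + N
      ≡⟨ trans (+-assoc N N N) (cong (λ t → N + (N + t)) (sym (+-identityʳ N))) ⟩
    3 * N ∎
    where
    open ≤-Reasoning
    height : ℕ → ℕ → ℕ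
    height p q = hvPalFactorsOfSize p (suc q) w
    #ends : (ℕ → Fin k) → ℕ → ℕ
    #ends x q = length (newPalindromeEnds x N q)
    #uvEnds : ℕ
    #uvEnds = sum (map (λ q → length (Pairs.newPalindromeEnds uv N q)) (upTo N))

aba-isHVPal : {A : Set} (n : ℕ) (a b : A) → IsHVPal (aba n a b)
aba-isHVPal n a b = (λ { 0F _ → refl ; 1F _ → refl ; 2F _ → refl })
                  , (λ _ → λ { 0F → refl ; 1F → refl ; 2F → refl })

module _ {k n : ℕ} {a b : Fin k} where

  band : (p i : ℕ) → i + p ≤ 3 → {q : ℕ} → q < n → Word2 (Fin k) p (suc q)
  band p i h q<n r s = aba n a b (shift 3 p i h r) (shift n _ 0 q<n s)

  band-∈ : (p i : ℕ) (h : i + p ≤ 3) → i < 3 → {q : ℕ} (q<n : q < n) →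
    band p i h q<n ∈ factorsOfSize p (suc q) (aba n a b)
  band-∈ p i h i<3 q<n = ∈-factorsOfSize⁺ (aba n a b) h q<n i<3 (≤-trans (s≤s z≤n) q<n)

  height1-≥2 : a ≢ b → {q : ℕ} → q < n → 2 ≤ hvPalFactorsOfSize 1 (suc q) (aba n a b)
  height1-≥2 a≢b q<n =
    length-≤-hvPalFactorsOfSize (aba n a b) (band 1 0 1≤3 q<n ∷ band 1 1 2≤3 q<n ∷ [])
      (((λ a≈b → a≢b (a≈b 0F 0F)) ∷ []) ∷ [] ∷ [])
      λ { (here refl) → band-∈ 1 0 1≤3 (s≤s z≤n) q<n ,
                        ((λ { 0F _ → refl }) , (λ _ → λ { 0F → refl }))
        ; (there (here refl)) → band-∈ 1 1 2≤3 (s≤s (s≤s z≤n)) q<n ,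
                                ((λ { 0F _ → refl }) , (λ _ → λ { 0F → refl })) }
    where
    1≤3 : 1 ≤ 3
    1≤3 = s≤s z≤n
    2≤3 : 2 ≤ 3
    2≤3 = s≤s (s≤s z≤n)

  height3-≥1 : {q : ℕ} → q < n → 1 ≤ hvPalFactorsOfSize 3 (suc q) (aba n a b)
  height3-≥1 q<n =
    length-≤-hvPalFactorsOfSize (aba n a b) (band 3 0 ≤-refl q<n ∷ []) ([] ∷ [])
      λ { (here refl) → band-∈ 3 0 ≤-refl (s≤s z≤n) q<n ,
                        ((λ { 0F _ → refl ; 1F _ → refl ; 2F _ → refl }) ,
                         (λ _ → λ { 0F → refl ; 1F → refl ; 2F → refl })) }

  numHVPalFactors-aba-≥ : a ≢ b → 3 * n ≤ numHVPalFactors (aba n a b)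
  numHVPalFactors-aba-≥ a≢b = begin
    3 * n
      ≡⟨ *-distribʳ-+ n 2 1 ⟩
    2 * n + 1 * n
      ≡⟨ sym (cong₂ _+_ (sum-upTo-const 2) (sum-upTo-const 1)) ⟩
    sum (map (λ _ → 2) (upTo n)) + sum (map (λ _ → 1) (upTo n))
      ≤⟨ +-mono-≤ (sum-map-mono-≤ (upTo n) (λ q∈ → height1-≥2 a≢b (∈-upTo⁻ q∈)))
                  (sum-map-mono-≤ (upTo n) (λ q∈ → height3-≥1 (∈-upTo⁻ q∈))) ⟩
    h₁ + h₃
      ≤⟨ +-monoˡ-≤ h₃ (m≤m+n h₁ h₂) ⟩
    h₁ + h₂ + h₃
      ≡⟨ sym (numHVPalFactors-height3 (aba n a b)) ⟩
    numHVPalFactors (aba n a b) ∎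
    where
    open ≤-Reasoning
    h₁ h₂ h₃ : ℕ
    h₁ = hvPalFactorsOfHeight 1 (aba n a b)
    h₂ = hvPalFactorsOfHeight 2 (aba n a b)
    h₃ = hvPalFactorsOfHeight 3 (aba n a b)
    sum-upTo-const : ∀ c → sum (map (λ _ → c) (upTo n)) ≡ c * n
    sum-upTo-const c = trans (sum-map-const c (upTo n)) (cong (c *_) (length-upTo n))

lemma5p9 : (n : ℕ) → 1 ≤ n →
    ((k : ℕ) (w : Word2 (Fin k) 3 n) → IsHVPal w → numHVPalFactors w ≤ 3 * n)
    × ((k : ℕ) (a b : Fin k) → a ≢ b → numHVPalFactors (aba n a b) ≡ 3 * n)
lemma5p9 (suc n) _ = upper , exact
  where
  upper : (k : ℕ) (w : Word2 (Fin k) 3 (suc n)) → IsHVPal w → numHVPalFactors w ≤ 3 * suc n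
  upper k w w-hv = ThreeRows.numHVPalFactors-≤ w w-hv
  exact : (k : ℕ) (a b : Fin k) → a ≢ b → numHVPalFactors (aba (suc n) a b) ≡ 3 * suc n
  exact k a b a≢b =
    ≤-antisym (upper k (aba (suc n) a b) (aba-isHVPal (suc n) a b)) (numHVPalFactors-aba-≥ {n = suc n} a≢b)
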